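{- Let $\mathcal{N}$ be the following negotiation over agents $A$ and $B$: atoms $n_0, n_1, n_2, n_f$, each with parties $\{A,B\}$; $n_0$ has the single outcome $a$, $n_1$ and $n_2$ have outcomes $a$ and $b$, and $n_f$ has some outcome. For both agents $c \in \{A,B\}$: $\mathcal{X}(n_0,c,a)=\{n_1\}$, $\mathcal{X}(n_1,c,a)=\{n_2\}$, $\mathcal{X}(n_1,c,b)=\{n_f\}$, $\mathcal{X}(n_2,c,a)=\{n_1\}$, $\mathcal{X}(n_2,c,b)=\{n_f\}$, $\mathcal{X}(n_f,c,r)=\emptyset$. Consider any negotiation $\mathcal{N}'$ obtained from $\mathcal{N}$ by adding finitely many new deterministic agents (each new agent is a party of $n_0$ and $n_f$ and possibly of further atoms among $n_1,n_2$, with deterministic transitions), keeping the atoms, their outcomes, and the transitions of $A$ and $B$ unchanged, and partition the agents of $\mathcal{N}'$ into $A_1 \ni A$ and $A_2 \ni B$. Then it is not possible that $\mathcal{N}'$ is sound, $n_1$ is controlled by Player 1 and $n_2$ is controlled by Player 2.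
   Context: A negotiation over a finite set of agents consists of a finite set $N$ of atoms, each atom $n$ having a nonempty set of parties $P_n$ (agents) and a finite nonempty set of outcomes $R_n$, an initial atom $n_0$ and a final atom $n_f$ in which every agent participates, and a transition function $\mathcal{X}$ assigning to each triple $(n,a,r)$ with $a\in P_n$, $r\in R_n$ a set of atoms $\mathcal{X}(n,a,r)$, which is empty iff $n=n_f$. A marking is a map $x$ from agents to sets of atoms; the initial marking has $x_0(a)=\{n_0\}$ for all $a$, the final marking has $x_f(a)=\emptyset$ for all $a$. A marking $x$ enables $n$ if $n\in x(a)$ for all $a\in P_n$; then $(n,r)$ may occur, yielding $x'$ with $x'(a)=\mathcal{X}(n,a,r)$ for $a\in P_n$ and $x'(a)=x(a)$ otherwise. The negotiation is sound if (a) every atom is enabled at some marking reachable from $x_0$, and (b) every occurrence sequence from $x_0$ either leads to $x_f$ or can be extended to one that leads to $x_f$. An agent $a$ is deterministic if for every atom $n\neq n_f$ with $a\in P_n$ and every $r\in R_n$, $\mathcal{X}(n,a,r)$ is a singleton. Given a partition of the agents into $A_1$ and $A_2$, an atom $n$ is controlled by Player 1 if $|P_n\cap A_1|>|P_n\cap A_2|$, and by Player 2 otherwise. -}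

module Defs where

open import Data.Nat using (ℕ; zero; suc; _<_; _≤_; _+_)
open import Data.Fin using (Fin; zero; suc)
open import Data.Fin.Subset using (Subset; _∈_; _∉_; ⁅_⁆; ⊥; ∣_∣; _∩_; ∁; Nonempty)
open import Data.Vec using (lookup)
open import Data.Bool using (if_then_else_)
open import Data.Product using (_×_; ∃; Σ)
open import Relation.Binary.PropositionalEquality using (_≡_)
open import Relation.Nullary using (¬_)
open import Relation.Binary.Construct.Closure.ReflexiveTransitive using (Star)

-- Agents are Fin nA, atoms are Fin nN, outcomes of atom n are Fin (R n).
-- The transition function is total in the agent argument; only its values
-- for parties a ∈ P n are ever used / constrained.

record Negotiation (nA nN : ℕ) (R : Fin nN → ℕ) : Set where
  field
    P  : Fin nN → Subset nA
    X  : (n : Fin nN) → Fin nA → Fin (R n) → Subset nN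
    n₀ : Fin nN
    nf : Fin nN

open Negotiation public

record IsNegotiation {nA nN : ℕ} {R : Fin nN → ℕ} (N : Negotiation nA nN R) : Set where
  field
    parties-nonempty  : ∀ n → Nonempty (P N n)
    outcomes-nonempty : ∀ n → 0 < R n
    n₀-all            : ∀ a → a ∈ P N (n₀ N)
    nf-all            : ∀ a → a ∈ P N (nf N)
    X-empty-iff-final : ∀ n a → a ∈ P N n → ∀ r → (X N n a r ≡ ⊥ → n ≡ nf N) × (n ≡ nf N → X N n a r ≡ ⊥)

module _ {nA nN : ℕ} {R : Fin nN → ℕ} (N : Negotiation nA nN R) where

  Marking : Set
  Marking = Fin nA → Subset nN

  initial : Marking
  initial a = ⁅ n₀ N ⁆

  IsFinal : Marking → Set
  IsFinal x = ∀ a → x a ≡ ⊥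

  Enables : Marking → Fin nN → Set
  Enables x n = ∀ a → a ∈ P N n → n ∈ x a

  occur : Marking → (n : Fin nN) → Fin (R n) → Marking
  occur x n r a = if lookup (P N n) a then X N n a r else x a

  data Step : Marking → Marking → Set where
    step : ∀ {x} n r → Enables x n → Step x (occur x n r)

  Reach : Marking → Marking → Set
  Reach = Star Step

  Sound : Set
  Sound = (∀ n → ∃ λ x → Reach initial x × Enables x n)
        × (∀ x → Reach initial x → ∃ λ y → Reach x y × IsFinal y)

  Deterministic : Fin nA → Set
  Deterministic a = ∀ n → ¬ (n ≡ nf N) → a ∈ P N n → ∀ r → ∃ λ m → X N n a r ≡ ⁅ m ⁆

  -- partition: A₁ = p, A₂ = ∁ p
  ControlledBy1 : Subset nA → Fin nN → Set
  ControlledBy1 p n = ∣ P N n ∩ ∁ p ∣ < ∣ P N n ∩ p ∣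

  ControlledBy2 : Subset nA → Fin nN → Set
  ControlledBy2 p n = ¬ ControlledBy1 p n

agA : {k : ℕ} → Fin (2 + k)
agA = zero

agB : {k : ℕ} → Fin (2 + k)
agB = suc zero

new : {k : ℕ} → Fin k → Fin (2 + k)
new i = suc (suc i)

at0 at1 at2 atf : Fin 4
at0 = zero
at1 = suc zero
at2 = suc (suc zero)
atf = suc (suc (suc zero))

-- outcomes: n0 has 1 outcome (a), n1 and n2 have 2 (a = 0, b = 1),
-- nf has suc m outcomes (some nonempty set).
outs : ℕ → Fin 4 → ℕ
outs m zero = 1
outs m (suc zero) = 2
outs m (suc (suc zero)) = 2
outs m (suc (suc (suc zero))) = suc m

oa : Fin 1
oa = zero

oa₂ ob₂ : Fin 2
oa₂ = zero
ob₂ = suc zero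

OrigTransitions : {k m : ℕ} → Negotiation (2 + k) 4 (outs m) → Fin (2 + k) → Set
OrigTransitions N c =
    (X N at0 c oa ≡ ⁅ at1 ⁆)
  × (X N at1 c oa₂ ≡ ⁅ at2 ⁆)
  × (X N at1 c ob₂ ≡ ⁅ atf ⁆)
  × (X N at2 c oa₂ ≡ ⁅ at1 ⁆)
  × (X N at2 c ob₂ ≡ ⁅ atf ⁆)
  × (∀ r → X N atf c r ≡ ⊥)

module Submission where

-- Agent A takes part in every atom, so in a sound
-- negotiation any reachable marking with A's marking ⁅ n ⁆ must enable n:
-- it is not final, and every atom it enables involves A, hence is n.
-- Consequently an agent j that is NOT a party of n but IS a party of a
-- successor u of n (reached by A through some outcome) must already hold
-- u in its marking, because after that outcome u is enabled while j has
-- not moved.  If j is deterministic its marking is a singleton, so it can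
-- hold at most one such successor.  In the example both n₁ and n₂ have
-- two outcomes leading A to distinct atoms (n₂ or n_f from n₁, n₁ or n_f
-- from n₂), and every new agent is a party of n_f; hence a new agent
-- taking part in exactly one of n₁, n₂ is impossible, i.e. n₁ and n₂
-- have the same parties.  Control by a player depends only on the set of
-- parties, so n₁ and n₂ cannot be controlled by different players.

open import Defs
open import Data.Nat using (ℕ; _+_; _<_)
open import Data.Fin using (Fin; zero; suc)
open import Data.Fin.Subset using (Subset; _∈_; _∉_; ⁅_⁆; _⊆_)
import Data.Fin.Subset as Subset
open import Data.Fin.Subset.Properties using (x∈⁅x⁆; x∈⁅y⁆⇒x≡y; ⊆-antisym; _∈?_; ∉⊥)
open import Data.Vec using (lookup)
open import Data.Vec.Properties using ([]=⇒lookup; lookup⇒[]=)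
open import Data.Bool using (true; false)
open import Data.Product using (_×_; _,_; proj₁; proj₂; ∃)
open import Data.Empty using (⊥-elim)
open import Relation.Binary.PropositionalEquality using (_≡_; _≢_; refl; sym; trans; subst; cong)
open import Relation.Nullary using (¬_; yes; no)
open import Relation.Binary.Construct.Closure.ReflexiveTransitive using (ε; _◅_; _◅◅_)

module _ {nA nN : ℕ} {R : Fin nN → ℕ} (N : Negotiation nA nN R) where

  occur-party : ∀ (x : Marking N) n r a → a ∈ P N n → occur N x n r a ≡ X N n a r
  occur-party x n r a a∈Pn rewrite []=⇒lookup a∈Pn = refl

  occur-idle : ∀ (x : Marking N) n r a → a ∉ P N n → occur N x n r a ≡ x a
  occur-idle x n r a a∉Pn with lookup (P N n) a in eq
  ... | true  = ⊥-elim (a∉Pn (lookup⇒[]= a (P N n) eq))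
  ... | false = refl

  reach-step : ∀ {x} n r → Reach N (initial N) x → Enables N x n
             → Reach N (initial N) (occur N x n r)
  reach-step n r x-reach x-enables = x-reach ◅◅ (step n r x-enables ◅ ε)

  module Leader (sound : Sound N) (a : Fin nA) (a-everywhere : ∀ n → a ∈ P N n) where

    -- If the leader a sits at the single atom n in a reachable marking,
    -- soundness forces n to be enabled there (otherwise the marking would
    -- be a dead, non-final marking).
    leader-enables : ∀ {x} n → Reach N (initial N) x → x a ≡ ⁅ n ⁆ → Enables N x n
    leader-enables {x} n x-reach xa≡n with proj₂ sound x x-reach
    ... | _ , ε , final = ⊥-elim (∉⊥ (subst (n ∈_) (trans (sym xa≡n) (final a)) (x∈⁅x⁆ n)))
    ... | _ , (step n′ _ enables′ ◅ _) , _ =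
      subst (Enables N x) n′≡n enables′
      where
      n′≡n : n′ ≡ n
      n′≡n = x∈⁅y⁆⇒x≡y n (subst (n′ ∈_) xa≡n (enables′ a (a-everywhere n′)))

    idle-agent-waits : ∀ {x} n r u j → Reach N (initial N) x → x a ≡ ⁅ n ⁆
                     → X N n a r ≡ ⁅ u ⁆ → j ∉ P N n → j ∈ P N u → u ∈ x j
    idle-agent-waits {x} n r u j x-reach xa≡n Xa≡u j∉Pn j∈Pu =
      subst (u ∈_) (occur-idle x n r j j∉Pn) (leader-enables u y-reach ya≡u j j∈Pu)
      where
      y-reach : Reach N (initial N) (occur N x n r)
      y-reach = reach-step n r x-reach (leader-enables n x-reach xa≡n)
      ya≡u : occur N x n r a ≡ ⁅ u ⁆
      ya≡u = trans (occur-party x n r a (a-everywhere n)) Xa≡u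

    idle-singleton-agent : ∀ {x} n r r′ u v j m → Reach N (initial N) x → x a ≡ ⁅ n ⁆
                         → X N n a r ≡ ⁅ u ⁆ → X N n a r′ ≡ ⁅ v ⁆ → x j ≡ ⁅ m ⁆
                         → j ∉ P N n → j ∈ P N u → j ∈ P N v → u ≡ v
    idle-singleton-agent n r r′ u v j m x-reach xa≡n Xa≡u Xa≡v xj≡m j∉Pn j∈Pu j∈Pv =
      trans (x∈⁅y⁆⇒x≡y m u∈m) (sym (x∈⁅y⁆⇒x≡y m v∈m))
      where
      u∈m : u ∈ ⁅ m ⁆
      u∈m = subst (u ∈_) xj≡m (idle-agent-waits n r u j x-reach xa≡n Xa≡u j∉Pn j∈Pu)
      v∈m : v ∈ ⁅ m ⁆
      v∈m = subst (v ∈_) xj≡m (idle-agent-waits n r′ v j x-reach xa≡n Xa≡v j∉Pn j∈Pv)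

controlled-by-same-parties : ∀ {nA nN R} (N : Negotiation nA nN R) p n n′
                           → P N n ≡ P N n′ → ControlledBy1 N p n → ControlledBy1 N p n′
controlled-by-same-parties N p n n′ Pn≡Pn′ c =
  subst (λ Q → Subset.∣ Q Subset.∩ Subset.∁ p ∣ < Subset.∣ Q Subset.∩ p ∣) Pn≡Pn′ c

module Example (k m : ℕ) (N : Negotiation (2 + k) 4 (outs m))
    (n₀≡at0 : n₀ N ≡ at0) (nf≡atf : nf N ≡ atf)
    (A-everywhere : ∀ n → agA ∈ P N n) (B-everywhere : ∀ n → agB ∈ P N n)
    (A-moves : OrigTransitions N agA)
    (new-at0 : ∀ i → new i ∈ P N at0) (new-atf : ∀ i → new i ∈ P N atf)
    (new-det : ∀ i → Deterministic N (new i))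
    (sound : Sound N) where

  open Leader N sound agA A-everywhere

  new-singleton : ∀ (x : Marking N) i n r → n ≢ atf → new i ∈ P N n
                → ∃ λ mm → occur N x n r (new i) ≡ ⁅ mm ⁆
  new-singleton x i n r n≢atf i∈Pn with new-det i n (λ n≡nf → n≢atf (trans n≡nf nf≡atf)) i∈Pn r
  ... | mm , X≡mm = mm , trans (occur-party N x n r (new i) i∈Pn) X≡mm

  x₁ : Marking N
  x₁ = occur N (initial N) at0 oa

  x₁-reach : Reach N (initial N) x₁
  x₁-reach = reach-step N at0 oa ε (leader-enables at0 ε (cong ⁅_⁆ n₀≡at0))

  x₁-A : x₁ agA ≡ ⁅ at1 ⁆
  x₁-A = trans (occur-party N (initial N) at0 oa agA (A-everywhere at0)) (proj₁ A-moves)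

  x₂ : Marking N
  x₂ = occur N x₁ at1 oa₂

  x₂-reach : Reach N (initial N) x₂
  x₂-reach = reach-step N at1 oa₂ x₁-reach (leader-enables at1 x₁-reach x₁-A)

  x₂-A : x₂ agA ≡ ⁅ at2 ⁆
  x₂-A = trans (occur-party N x₁ at1 oa₂ agA (A-everywhere at1)) (proj₁ (proj₂ A-moves))

  -- A new agent idle at n₁ but a party of n₂ would wait at both n₂ and n_f in x₁.
  n₂-parties-at-n₁ : P N at2 ⊆ P N at1
  n₂-parties-at-n₁ {zero} _ = A-everywhere at1
  n₂-parties-at-n₁ {suc zero} _ = B-everywhere at1
  n₂-parties-at-n₁ {suc (suc i)} i∈P₂ with new i ∈? P N at1
  ... | yes i∈P₁ = i∈P₁
  ... | no i∉P₁ with new-singleton (initial N) i at0 oa (λ ()) (new-at0 i)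
  ...   | mm , x₁-i with idle-singleton-agent at1 oa₂ ob₂ at2 atf (new i) mm x₁-reach x₁-A
                         (proj₁ (proj₂ A-moves)) (proj₁ (proj₂ (proj₂ A-moves))) x₁-i
                         i∉P₁ i∈P₂ (new-atf i)
  ...     | ()

  -- A new agent idle at n₂ but a party of n₁ would wait at both n₁ and n_f in x₂.
  n₁-parties-at-n₂ : P N at1 ⊆ P N at2
  n₁-parties-at-n₂ {zero} _ = A-everywhere at2
  n₁-parties-at-n₂ {suc zero} _ = B-everywhere at2
  n₁-parties-at-n₂ {suc (suc i)} i∈P₁ with new i ∈? P N at2
  ... | yes i∈P₂ = i∈P₂
  ... | no i∉P₂ with new-singleton x₁ i at1 oa₂ (λ ()) i∈P₁
  ...   | mm , x₂-i with idle-singleton-agent at2 oa₂ ob₂ at1 atf (new i) mm x₂-reach x₂-A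
                         (proj₁ (proj₂ (proj₂ (proj₂ A-moves))))
                         (proj₁ (proj₂ (proj₂ (proj₂ (proj₂ A-moves))))) x₂-i
                         i∉P₂ i∈P₁ (new-atf i)
  ...     | ()

  same-parties : P N at1 ≡ P N at2
  same-parties = ⊆-antisym n₁-parties-at-n₂ n₂-parties-at-n₁

lemma1 : (k m : ℕ) (N : Negotiation (2 + k) 4 (outs m)) → IsNegotiation N
    → n₀ N ≡ at0 → nf N ≡ atf
    → (∀ n → agA ∈ P N n) → (∀ n → agB ∈ P N n)
    → OrigTransitions N agA → OrigTransitions N agB
    → (∀ i → new i ∈ P N at0) → (∀ i → new i ∈ P N atf)
    → (∀ i → Deterministic N (new i))
    → (p : Subset (2 + k)) → agA ∈ p → agB ∉ p
    → ¬ (Sound N × ControlledBy1 N p at1 × ControlledBy2 N p at2)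
lemma1 k m N _ n₀≡at0 nf≡atf A-everywhere B-everywhere A-moves _ new-at0 new-atf new-det
       p _ _ (sound , n₁-by-1 , n₂-by-2) =
  n₂-by-2 (controlled-by-same-parties N p at1 at2 parties₁≡₂ n₁-by-1)
  where
  parties₁≡₂ : P N at1 ≡ P N at2
  parties₁≡₂ = Example.same-parties k m N n₀≡at0 nf≡atf A-everywhere B-everywhere
                 A-moves new-at0 new-atf new-det sound
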